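{- Let $\ell\ge 1$ and let $V_\ell\subset\mathbb{A}^{2\ell+1}$ be the affine variety with coordinates $b,x_1,y_1,\dots,x_\ell,y_\ell$ defined by the $\ell$ equations $x_i^2+y_i^2=x_{i+1}+b\,y_{i+1}$ for $i=1,\dots,\ell-1$ and $x_\ell^2+y_\ell^2=x_1+b\,y_1$ (for $\ell=1$ this is the single equation $x_1^2+y_1^2=x_1+by_1$). Let $P=(b_0,\mathbf{x}_1,\mathbf{y}_1,\dots,\mathbf{x}_\ell,\mathbf{y}_\ell)$ be any point of $V_\ell$ with coordinates in $\mathbb{C}$. Then the line in $\mathbb{A}^{2\ell+1}$ given parametrically by $$b(t)=b_0+(b_0^2+1)t,\qquad x_i(t)=\mathbf{x}_i+(\mathbf{x}_ib_0-\mathbf{y}_i)t,\qquad y_i(t)=\mathbf{y}_i+(\mathbf{y}_ib_0+\mathbf{x}_i)t\quad(i=1,\dots,\ell)$$ passes through $P$ and is entirely contained in $V_\ell$. Moreover, if $P$ has integer coordinates and corresponds to a propagating $\ell$-cycle of $S_{x^2,b_0}$, then for every non-negative integer $\mathbf{t}$, the integer point $P(\mathbf{t})=(b(\mathbf{t}),x_1(\mathbf{t}),y_1(\mathbf{t}),\dots,x_\ell(\mathbf{t}),y_\ell(\mathbf{t}))$ corresponds to a propagating $\ell$-cycle of $S_{x^2,b(\mathbf{t})}$.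
   Context: For an integer $b\ge2$ and a map $\phi$ from $\{0,\dots,b-1\}$ to $\mathbb{Z}_{\ge0}$, define $S_{\phi,b}:\mathbb{Z}_{\ge0}\to\mathbb{Z}_{\ge0}$ by $S_{\phi,b}(n)=\phi(x_0)+\dots+\phi(x_d)$, where $n=x_0+x_1b+\dots+x_db^d$ is the base-$b$ expansion of $n$ ($0\le x_i<b$). A cycle of length $\ell$ (an $\ell$-cycle) of $S_{\phi,b}$ is a sequence of pairwise distinct positive integers $\mathrm{cyc}(n_1,\dots,n_\ell)$ with $S_{\phi,b}(n_i)=n_{i+1}$ for $1\le i<\ell$ and $S_{\phi,b}(n_\ell)=n_1$, considered up to cyclic permutation. Here $\phi(x)=x^2$. An $\ell$-cycle $\mathrm{cyc}(n_1,\dots,n_\ell)$ of $S_{x^2,b}$ is propagating if every $n_i$ has at most two base-$b$ digits and $b$ divides no $n_i$. Writing $n_i=\mathbf{x}_i+\mathbf{y}_ib$ with $0\le\mathbf{x}_i,\mathbf{y}_i\le b-1$ and $\mathbf{x}_i\neq0$, a propagating $\ell$-cycle of $S_{x^2,b}$ corresponds to the integer point $(b,\mathbf{x}_1,\mathbf{y}_1,\dots,\mathbf{x}_\ell,\mathbf{y}_\ell)$ of $V_\ell$; conversely, an integer point of $V_\ell$ with $0\le\mathbf{x}_i,\mathbf{y}_i\le b-1$ and $\mathbf{x}_i\ne0$ is said to correspond to the cycle $\mathrm{cyc}(\mathbf{x}_1+b\mathbf{y}_1,\dots,\mathbf{x}_\ell+b\mathbf{y}_\ell)$. -}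

module Defs where

open import Level using (Level)
open import Data.Nat as ℕ using (ℕ; zero; suc; NonZero)
open import Data.Nat.DivMod using (_%_; _/_; m%n<n)
open import Data.Nat.Divisibility using (_∣_)
open import Data.Fin using (Fin; toℕ; fromℕ<)
open import Data.List using (List; []; _∷_; map)
open import Data.Nat.ListAction using (sum)
open import Data.Integer as ℤ using (ℤ; +_; ∣_∣)
open import Data.Integer.Properties using (+-*-commutativeRing)
open import Data.Product using (_×_)
open import Relation.Nullary using (¬_; yes; no)
open import Relation.Binary.PropositionalEquality using (_≡_; _≢_)
open import Function.Definitions using (Injective)
open import Algebra.Bundles using (CommutativeRing)

next : ∀ {k} → Fin (suc k) → Fin (suc k)
next {k} i = fromℕ< (m%n<n (suc (toℕ i)) (suc k))

module _ {c r : Level} (R : CommutativeRing c r) where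
  open CommutativeRing R

  InV : ∀ {k} → Carrier → (Fin (suc k) → Carrier) → (Fin (suc k) → Carrier) → Set r
  InV b xs ys = ∀ i → xs i * xs i + ys i * ys i ≈ xs (next i) + b * ys (next i)

  lineB : Carrier → Carrier → Carrier
  lineB b0 t = b0 + (b0 * b0 + 1#) * t

  lineX : ∀ {k} → Carrier → (Fin (suc k) → Carrier) → (Fin (suc k) → Carrier) → Carrier → Fin (suc k) → Carrier
  lineX b0 xs ys t i = xs i + (xs i * b0 + - ys i) * t

  lineY : ∀ {k} → Carrier → (Fin (suc k) → Carrier) → (Fin (suc k) → Carrier) → Carrier → Fin (suc k) → Carrier
  lineY b0 xs ys t i = ys i + (ys i * b0 + xs i) * t

digitsF : (b : ℕ) → .{{_ : NonZero b}} → ℕ → ℕ → List ℕ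
digitsF b zero    n = []
digitsF b (suc f) n with n ℕ.<? b
... | yes _ = n ∷ []
... | no  _ = n % b ∷ digitsF b f (n / b)

-- base-b expansion of n (fuel n+1 suffices since b ≥ 2)
digits : (b : ℕ) → .{{_ : NonZero b}} → ℕ → List ℕ
digits b n = digitsF b (suc n) n

-- S_{φ,b}(n) = φ(x_0) + ... + φ(x_d); only meaningful for b ≥ 2 (junk value 0 otherwise)
S : (ℕ → ℕ) → ℕ → ℕ → ℕ
S φ zero          n = 0
S φ (suc zero)    n = 0
S φ (suc (suc k)) n = sum (map φ (digits (suc (suc k)) n))

sq : ℕ → ℕ
sq x = x ℕ.* x

IsCycle : (ℕ → ℕ) → ℕ → ∀ {k} → (Fin (suc k) → ℕ) → Set
IsCycle φ b ns = (∀ i → 0 ℕ.< ns i) × Injective _≡_ _≡_ ns × (∀ i → S φ b (ns i) ≡ ns (next i))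

IsPropagatingCycle : ℕ → ∀ {k} → (Fin (suc k) → ℕ) → Set
IsPropagatingCycle b ns = IsCycle sq b ns × (∀ i → ns i ℕ.< b ℕ.* b) × (∀ i → ¬ (b ∣ ns i))

ℤring : CommutativeRing _ _
ℤring = +-*-commutativeRing

Corresponds : ∀ {k} → ℤ → (Fin (suc k) → ℤ) → (Fin (suc k) → ℤ) → Set
Corresponds b xs ys =
  (+ 2 ℤ.≤ b) × InV ℤring b xs ys
  × (∀ i → (+ 0 ℤ.≤ xs i) × (xs i ℤ.≤ b ℤ.- + 1))
  × (∀ i → (+ 0 ℤ.≤ ys i) × (ys i ℤ.≤ b ℤ.- + 1))
  × (∀ i → xs i ≢ + 0)
  × IsPropagatingCycle ∣ b ∣ (λ i → ∣ xs i ℤ.+ b ℤ.* ys i ∣)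

-- Identify (x, y) with the Gaussian number z = x + iy.  Along the line z(t) = z (1 + (b + i) t)
-- and b(t) + i = (b + i)(1 + (b - i) t), while x + b y = Im((b + i) z).  Hence both sides of every
-- equation of V_ℓ get multiplied by the same factor K(t) = |1 + (b + i) t|² = (1 + b t)² + t².
-- For a propagating cycle with 0 ≤ t the new coordinates are still base-b(t) digits, and the new
-- numerals x_i(t) + b(t) y_i(t) are K(t) times the old ones, so they stay pairwise distinct.
module Submission where

open import Defs
open import Data.Nat using (ℕ; suc)
open import Data.Fin using (Fin)
open import Data.Integer using (ℤ; +_)
open import Data.Product using (_×_; _,_)
open import Algebra.Bundles using (CommutativeRing)

module LineInRing {c r} (R : CommutativeRing c r) where
  open CommutativeRing R
  open import Algebra.Solver.Ring.NaturalCoefficients.Default commutativeSemiring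
  open import Relation.Binary.Reasoning.Setoid setoid

  lineScale : Carrier → Carrier → Carrier
  lineScale b t = (1# + b * t) * (1# + b * t) + t * t

  private
    drop-multiple : ∀ {a z p} → z ≈ 0# → a + z * p ≈ a
    drop-multiple {a} {z} {p} z≈0 = begin
      a + z * p  ≈⟨ +-congˡ (*-congʳ z≈0) ⟩
      a + 0# * p ≈⟨ +-congˡ (zeroˡ p) ⟩
      a + 0#     ≈⟨ +-identityʳ a ⟩
      a          ∎

    cancel-multiples : ∀ {a c z p q} → z ≈ 0# → a + z * p ≈ c + z * q → a ≈ c
    cancel-multiples z≈0 eq = trans (sym (drop-multiple z≈0)) (trans eq (drop-multiple z≈0))

  -- The solver only handles commutative semirings: -y becomes a fresh variable n, and the
  -- identities are verified up to multiples of n + y.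
  line-sumSq : ∀ b x y t →
    (x + (x * b + - y) * t) * (x + (x * b + - y) * t) + (y + (y * b + x) * t) * (y + (y * b + x) * t)
      ≈ (x * x + y * y) * lineScale b t
  line-sumSq b x y t = cancel-multiples (-‿inverseˡ y) (identity x (- y) y b t)
    where
    identity : ∀ x n y b t →
      (x + (x * b + n) * t) * (x + (x * b + n) * t) + (y + (y * b + x) * t) * (y + (y * b + x) * t)
        + (n + y) * (y * (t * t))
      ≈ (x * x + y * y) * lineScale b t
        + (n + y) * (x * t + x * t + x * b * (t * t) + x * b * (t * t) + n * (t * t))
    identity = solve 5 (λ x n y b t →
      (x :+ (x :* b :+ n) :* t) :* (x :+ (x :* b :+ n) :* t) :+ (y :+ (y :* b :+ x) :* t) :* (y :+ (y :* b :+ x) :* t)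
        :+ (n :+ y) :* (y :* (t :* t))
      := (x :* x :+ y :* y) :* ((con 1 :+ b :* t) :* (con 1 :+ b :* t) :+ t :* t)
        :+ (n :+ y) :* (x :* t :+ x :* t :+ x :* b :* (t :* t) :+ x :* b :* (t :* t) :+ n :* (t :* t))) refl

  line-linear : ∀ b x y t →
    x + (x * b + - y) * t + lineB R b t * (y + (y * b + x) * t) ≈ (x + b * y) * lineScale b t
  line-linear b x y t = trans (identity x (- y) y b t) (drop-multiple (-‿inverseˡ y))
    where
    identity : ∀ x n y b t →
      x + (x * b + n) * t + (b + (b * b + 1#) * t) * (y + (y * b + x) * t)
        ≈ (x + b * y) * lineScale b t + (n + y) * t
    identity = solve 5 (λ x n y b t →
      x :+ (x :* b :+ n) :* t :+ (b :+ (b :* b :+ con 1) :* t) :* (y :+ (y :* b :+ x) :* t)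
      := (x :+ b :* y) :* ((con 1 :+ b :* t) :* (con 1 :+ b :* t) :+ t :* t) :+ (n :+ y) :* t) refl

  line-through-point : ∀ {k} b (xs ys : Fin (suc k) → Carrier) →
    (lineB R b 0# ≈ b) × (∀ i → lineX R b xs ys 0# i ≈ xs i) × (∀ i → lineY R b xs ys 0# i ≈ ys i)
  line-through-point b xs ys = +-zeroʳ-multiple , (λ _ → +-zeroʳ-multiple) , (λ _ → +-zeroʳ-multiple)
    where
    +-zeroʳ-multiple : ∀ {a d} → a + d * 0# ≈ a
    +-zeroʳ-multiple {a} {d} = trans (+-congˡ (zeroʳ d)) (+-identityʳ a)

  line⊆V : ∀ {k} b (xs ys : Fin (suc k) → Carrier) → InV R b xs ys →
    ∀ t → InV R (lineB R b t) (lineX R b xs ys t) (lineY R b xs ys t)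
  line⊆V b xs ys inV t i = begin
    _                                               ≈⟨ line-sumSq b (xs i) (ys i) t ⟩
    (xs i * xs i + ys i * ys i) * lineScale b t     ≈⟨ *-congʳ (inV i) ⟩
    (xs (next i) + b * ys (next i)) * lineScale b t ≈⟨ line-linear b (xs (next i)) (ys (next i)) t ⟨
    _                                               ∎

open import Data.Nat using (zero; _+_; _*_; _∸_; _<_; _≤_; z≤n; s≤s; z<s; NonZero; >-nonZero⁻¹; _<?_)
open import Data.Nat.Properties
open import Data.Nat.DivMod using (_%_; _/_; [m+kn]%n≡m%n; m<n⇒m%n≡m; m*n%n≡0; m<n⇒m/n≡0; m*n/n≡m; +-distrib-/)
open import Data.Nat.Divisibility using (_∣_; divides)
open import Data.Nat.ListAction using (sum)
open import Data.Integer as ℤ using (∣_∣; +≤+)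
open import Data.Integer.Properties using (pos-*; abs-*; +-injective; drop‿+≤+; m-n≡m⊖n; ⊖-≥)
open import Data.List using ([]; _∷_; map)
open import Data.Product using (proj₁)
open import Function using (_∘_)
open import Function.Definitions using (Injective)
open import Relation.Nullary using (¬_; yes; no; contradiction)
open import Relation.Binary.PropositionalEquality using (_≡_; refl; sym; trans; cong; cong₂; subst; module ≡-Reasoning)

open LineInRing using (lineScale; line-linear; line-through-point; line⊆V)

twoDigit<B*B : ∀ {B x y} → x < B → y < B → x + B * y < B * B
twoDigit<B*B {B} {x} {y} x<B y<B = begin-strict
  x + B * y <⟨ +-monoˡ-< (B * y) x<B ⟩
  B + B * y ≡⟨ *-suc B y ⟨
  B * suc y ≤⟨ *-monoʳ-≤ B y<B ⟩
  B * B     ∎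
  where open ≤-Reasoning

module TwoDigits (B : ℕ) .{{_ : NonZero B}} where

  %-twoDigit : ∀ {x} y → x < B → (x + B * y) % B ≡ x
  %-twoDigit {x} y x<B = begin
    (x + B * y) % B ≡⟨ cong (λ m → (x + m) % B) (*-comm B y) ⟩
    (x + y * B) % B ≡⟨ [m+kn]%n≡m%n x y B ⟩
    x % B           ≡⟨ m<n⇒m%n≡m x<B ⟩
    x               ∎
    where open ≡-Reasoning

  /-twoDigit : ∀ {x} y → x < B → (x + B * y) / B ≡ y
  /-twoDigit {x} y x<B = begin
    (x + B * y) / B   ≡⟨ cong (λ m → (x + m) / B) (*-comm B y) ⟩
    (x + y * B) / B   ≡⟨ +-distrib-/ x (y * B) remainders<B ⟩
    x / B + y * B / B ≡⟨ cong₂ _+_ (m<n⇒m/n≡0 x<B) (m*n/n≡m y B) ⟩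
    y                 ∎
    where
    open ≡-Reasoning
    remainders<B : x % B + (y * B) % B < B
    remainders<B = subst (_< B) (sym (trans (cong₂ _+_ (m<n⇒m%n≡m x<B) (m*n%n≡0 y B)) (+-identityʳ x))) x<B

  ∤twoDigit : ∀ {x} y → 0 < x → x < B → ¬ B ∣ x + B * y
  ∤twoDigit {x} y 0<x x<B (divides q eq) = <⇒≢ 0<x (begin
    0               ≡⟨ m*n%n≡0 q B ⟨
    (q * B) % B     ≡⟨ cong (_% B) eq ⟨
    (x + B * y) % B ≡⟨ %-twoDigit y x<B ⟩
    x               ∎)
    where open ≡-Reasoning

  digitsF-oneDigit : ∀ {f n} → 0 < f → n < B → digitsF B f n ≡ n ∷ []
  digitsF-oneDigit {suc f} {n} _ n<B with n <? B
  ... | yes _  = refl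
  ... | no n≮B = contradiction n<B n≮B

  digitsF-step : ∀ f {n} → B ≤ n → digitsF B (suc f) n ≡ n % B ∷ digitsF B f (n / B)
  digitsF-step f {n} B≤n with n <? B
  ... | yes n<B = contradiction n<B (≤⇒≯ B≤n)
  ... | no _    = refl

  digits-twoDigit : ∀ {x y} → x < B → y < B → 0 < y → digits B (x + B * y) ≡ x ∷ y ∷ []
  digits-twoDigit {x} {y} x<B y<B 0<y = begin
    digitsF B (suc n) n         ≡⟨ digitsF-step n B≤n ⟩
    n % B ∷ digitsF B n (n / B) ≡⟨ cong₂ (λ d m → d ∷ digitsF B n m) (%-twoDigit y x<B) (/-twoDigit y x<B) ⟩
    x ∷ digitsF B n y           ≡⟨ cong (x ∷_) (digitsF-oneDigit (<-≤-trans (>-nonZero⁻¹ B) B≤n) y<B) ⟩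
    x ∷ y ∷ []                  ∎
    where
    open ≡-Reasoning
    n = x + B * y
    B≤n : B ≤ n
    B≤n = ≤-trans (subst (_≤ B * y) (*-identityʳ B) (*-monoʳ-≤ B 0<y)) (m≤n+m (B * y) x)

open TwoDigits

S-sq-twoDigit : ∀ {b x y} → x < suc (suc b) → y < suc (suc b) →
  S sq (suc (suc b)) (x + suc (suc b) * y) ≡ sq x + sq y
S-sq-twoDigit {b} {x} {zero} x<B _ = begin
  S sq B (x + B * 0) ≡⟨ cong (S sq B) (trans (cong (λ m → x + m) (*-zeroʳ B)) (+-identityʳ x)) ⟩
  S sq B x           ≡⟨ cong (sum ∘ map sq) (digitsF-oneDigit B z<s x<B) ⟩
  sq x + 0           ∎
  where
  open ≡-Reasoning
  B = suc (suc b)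
S-sq-twoDigit {b} {x} {suc y} x<B y<B =
  trans (cong (sum ∘ map sq) (digits-twoDigit (suc (suc b)) x<B y<B z<s)) (cong (λ m → sq x + m) (+-identityʳ _))

isPropagatingCycle : ∀ {k B} {ns X Y : Fin (suc k) → ℕ} → 2 ≤ B → (∀ i → ns i ≡ X i + B * Y i) →
  (∀ i → 0 < X i) → (∀ i → X i < B) → (∀ i → Y i < B) →
  (∀ i → sq (X i) + sq (Y i) ≡ ns (next i)) → Injective _≡_ _≡_ ns → IsPropagatingCycle B ns
isPropagatingCycle {B = B@(suc (suc _))} {ns} {X} {Y} (s≤s (s≤s _)) ns≡ 0<X X<B Y<B cycle inj =
  ((λ i → subst (0 <_) (sym (ns≡ i)) (<-≤-trans (0<X i) (m≤m+n (X i) _))) , inj , S-step) ,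
  (λ i → subst (_< B * B) (sym (ns≡ i)) (twoDigit<B*B (X<B i) (Y<B i))) ,
  (λ i → ∤twoDigit B (Y i) (0<X i) (X<B i) ∘ subst (B ∣_) (ns≡ i))
  where
  S-step : ∀ i → S sq B (ns i) ≡ ns (next i)
  S-step i = trans (cong (S sq B) (ns≡ i)) (trans (S-sq-twoDigit (X<B i) (Y<B i)) (cycle i))

record DigitPoint {k} (B : ℕ) (xs ys : Fin (suc k) → ℤ) : Set where
  field
    X Y   : Fin (suc k) → ℕ
    xs≡+X : ∀ i → xs i ≡ + X i
    ys≡+Y : ∀ i → ys i ≡ + Y i
    0<X   : ∀ i → 0 < X i
    X<B   : ∀ i → X i < B
    Y<B   : ∀ i → Y i < B

corresponds⇒digitPoint : ∀ {k B} {xs ys : Fin (suc k) → ℤ} → Corresponds (+ B) xs ys → DigitPoint B xs ys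
corresponds⇒digitPoint {B = B} {xs} {ys} (+≤+ (s≤s (s≤s _)) , _ , x-bounds , y-bounds , x≢0 , _) = record
  { X     = ∣_∣ ∘ xs
  ; Y     = ∣_∣ ∘ ys
  ; xs≡+X = λ i → nonNeg≡+∣∣ (proj₁ (x-bounds i))
  ; ys≡+Y = λ i → nonNeg≡+∣∣ (proj₁ (y-bounds i))
  ; 0<X   = λ i → n≢0⇒n>0 (x≢0 i ∘ trans (nonNeg≡+∣∣ (proj₁ (x-bounds i))) ∘ cong (+_))
  ; X<B   = λ i → digit<B (x-bounds i)
  ; Y<B   = λ i → digit<B (y-bounds i)
  }
  where
  nonNeg≡+∣∣ : ∀ {z} → + 0 ℤ.≤ z → z ≡ + ∣ z ∣
  nonNeg≡+∣∣ (+≤+ _) = refl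
  digit<B : ∀ {z} → (+ 0 ℤ.≤ z) × (z ℤ.≤ + B ℤ.- + 1) → ∣ z ∣ < B
  digit<B (+≤+ _ , z≤B-1) = s≤s (drop‿+≤+ z≤B-1)

+-sumSq : ∀ X Y → + X ℤ.* + X ℤ.+ + Y ℤ.* + Y ≡ + (sq X + sq Y)
+-sumSq X Y = cong₂ ℤ._+_ (sym (pos-* X X)) (sym (pos-* Y Y))

+-twoDigit : ∀ B X Y → + X ℤ.+ + B ℤ.* + Y ≡ + (X + B * Y)
+-twoDigit B X Y = cong (λ m → + X ℤ.+ m) (sym (pos-* B Y))

digitPoint⇒corresponds : ∀ {k b B} {xs ys : Fin (suc k) → ℤ} → b ≡ + B → 2 ≤ B → DigitPoint B xs ys →
  InV ℤring b xs ys → Injective _≡_ _≡_ (λ i → ∣ xs i ℤ.+ b ℤ.* ys i ∣) → Corresponds b xs ys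
digitPoint⇒corresponds {B = B@(suc (suc _))} {xs} {ys} refl 2≤B@(s≤s (s≤s _)) d inV inj =
  +≤+ 2≤B , inV , (λ i → bounds (xs≡+X i) (X<B i)) , (λ i → bounds (ys≡+Y i) (Y<B i)) ,
  (λ i x≡0 → <⇒≢ (0<X i) (sym (+-injective (trans (sym (xs≡+X i)) x≡0)))) ,
  isPropagatingCycle 2≤B ns≡ 0<X X<B Y<B cycle inj
  where
  open DigitPoint d
  open ≡-Reasoning
  bounds : ∀ {z Z} → z ≡ + Z → Z < B → (+ 0 ℤ.≤ z) × (z ℤ.≤ + B ℤ.- + 1)
  bounds refl (s≤s Z≤B-1) = +≤+ z≤n , +≤+ Z≤B-1
  twoDigit≡ : ∀ i → xs i ℤ.+ + B ℤ.* ys i ≡ + (X i + B * Y i)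
  twoDigit≡ i = trans (cong₂ (λ x y → x ℤ.+ + B ℤ.* y) (xs≡+X i) (ys≡+Y i)) (+-twoDigit B (X i) (Y i))
  ns≡ : ∀ i → ∣ xs i ℤ.+ + B ℤ.* ys i ∣ ≡ X i + B * Y i
  ns≡ i = cong ∣_∣ (twoDigit≡ i)
  cycle : ∀ i → sq (X i) + sq (Y i) ≡ ∣ xs (next i) ℤ.+ + B ℤ.* ys (next i) ∣
  cycle i = cong ∣_∣ (begin
    + (sq (X i) + sq (Y i))               ≡⟨ +-sumSq (X i) (Y i) ⟨
    + X i ℤ.* + X i ℤ.+ + Y i ℤ.* + Y i   ≡⟨ cong₂ (λ x y → x ℤ.* x ℤ.+ y ℤ.* y) (xs≡+X i) (ys≡+Y i) ⟨
    xs i ℤ.* xs i ℤ.+ ys i ℤ.* ys i       ≡⟨ inV i ⟩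
    xs (next i) ℤ.+ + B ℤ.* ys (next i)   ∎)

lineX-+ : ∀ B {X Y} t → Y ≤ X * B → + X ℤ.+ (+ X ℤ.* + B ℤ.+ ℤ.- + Y) ℤ.* + t ≡ + (X + (X * B ∸ Y) * t)
lineX-+ B {X} {Y} t Y≤XB = begin
  + X ℤ.+ (+ X ℤ.* + B ℤ.+ ℤ.- + Y) ℤ.* + t ≡⟨ cong (λ m → + X ℤ.+ (m ℤ.+ ℤ.- + Y) ℤ.* + t) (sym (pos-* X B)) ⟩
  + X ℤ.+ (+ (X * B) ℤ.+ ℤ.- + Y) ℤ.* + t   ≡⟨ cong (λ m → + X ℤ.+ m ℤ.* + t) (trans (m-n≡m⊖n (X * B) Y) (⊖-≥ Y≤XB)) ⟩
  + X ℤ.+ + (X * B ∸ Y) ℤ.* + t             ≡⟨ cong (λ m → + X ℤ.+ m) (sym (pos-* (X * B ∸ Y) t)) ⟩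
  + (X + (X * B ∸ Y) * t)                   ∎
  where open ≡-Reasoning

lineY-+ : ∀ B X Y t → + Y ℤ.+ (+ Y ℤ.* + B ℤ.+ + X) ℤ.* + t ≡ + (Y + (Y * B + X) * t)
lineY-+ B X Y t =
  trans (cong (λ m → + Y ℤ.+ (m ℤ.+ + X) ℤ.* + t) (sym (pos-* Y B))) (cong (λ m → + Y ℤ.+ m) (sym (pos-* (Y * B + X) t)))

lineB-+ : ∀ B t → lineB ℤring (+ B) (+ t) ≡ + (B + (B * B + 1) * t)
lineB-+ B t =
  trans (cong (λ m → + B ℤ.+ (m ℤ.+ + 1) ℤ.* + t) (sym (pos-* B B))) (cong (λ m → + B ℤ.+ m) (sym (pos-* (B * B + 1) t)))

∣lineScale∣ : ∀ B t → ∣ lineScale ℤring (+ B) (+ t) ∣ ≡ suc (B * t) * suc (B * t) + t * t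
∣lineScale∣ B t = cong ∣_∣ (begin
  (+ 1 ℤ.+ + B ℤ.* + t) ℤ.* (+ 1 ℤ.+ + B ℤ.* + t) ℤ.+ + t ℤ.* + t
    ≡⟨ cong (λ m → (+ 1 ℤ.+ m) ℤ.* (+ 1 ℤ.+ m) ℤ.+ + t ℤ.* + t) (sym (pos-* B t)) ⟩
  + suc (B * t) ℤ.* + suc (B * t) ℤ.+ + t ℤ.* + t
    ≡⟨ +-sumSq (suc (B * t)) t ⟩
  + (suc (B * t) * suc (B * t) + t * t) ∎)
  where open ≡-Reasoning

digitPoint-along-line : ∀ {k B} {xs ys : Fin (suc k) → ℤ} t → DigitPoint B xs ys →
  DigitPoint (B + (B * B + 1) * t) (lineX ℤring (+ B) xs ys (+ t)) (lineY ℤring (+ B) xs ys (+ t))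
digitPoint-along-line {B = B} t d = record
  { X     = λ i → X i + (X i * B ∸ Y i) * t
  ; Y     = λ i → Y i + (Y i * B + X i) * t
  ; xs≡+X = λ i → trans (cong₂ (λ x y → x ℤ.+ (x ℤ.* + B ℤ.+ ℤ.- y) ℤ.* + t) (xs≡+X i) (ys≡+Y i)) (lineX-+ B t (Y≤XB i))
  ; ys≡+Y = λ i → trans (cong₂ (λ x y → y ℤ.+ (y ℤ.* + B ℤ.+ x) ℤ.* + t) (xs≡+X i) (ys≡+Y i)) (lineY-+ B (X i) (Y i) t)
  ; 0<X   = λ i → <-≤-trans (0<X i) (m≤m+n (X i) _)
  ; X<B   = λ i → +-mono-<-≤ (X<B i) (*-monoˡ-≤ t (XB∸Y≤BB+1 i))
  ; Y<B   = λ i → +-mono-<-≤ (Y<B i) (*-monoˡ-≤ t (YB+X≤BB+1 i))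
  }
  where
  open DigitPoint d
  Y≤XB : ∀ i → Y i ≤ X i * B
  Y≤XB i = ≤-trans (<⇒≤ (Y<B i)) (subst (_≤ X i * B) (*-identityˡ B) (*-monoˡ-≤ B (0<X i)))
  XB∸Y≤BB+1 : ∀ i → X i * B ∸ Y i ≤ B * B + 1
  XB∸Y≤BB+1 i = ≤-trans (m∸n≤m (X i * B) (Y i)) (≤-trans (*-monoˡ-≤ B (<⇒≤ (X<B i))) (m≤m+n (B * B) 1))
  YB+X≤BB+1 : ∀ i → Y i * B + X i ≤ B * B + 1
  YB+X≤BB+1 i = ≤-trans (<⇒≤ YB+X<BB) (m≤m+n (B * B) 1)
    where
    YB+X<BB : Y i * B + X i < B * B
    YB+X<BB = subst (_< B * B) (trans (+-comm (X i) _) (cong (_+ X i) (*-comm B (Y i))))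
                (twoDigit<B*B (X<B i) (Y<B i))

corresponds-along-line : ∀ k (b : ℤ) (xs ys : Fin (suc k) → ℤ) → Corresponds b xs ys →
  ∀ (t : ℕ) → Corresponds (lineB ℤring b (+ t)) (lineX ℤring b xs ys (+ t)) (lineY ℤring b xs ys (+ t))
corresponds-along-line k .(+ B) xs ys c@(+≤+ {n = B} 2≤B , inV , _ , _ , _ , (_ , inj , _) , _) t =
  digitPoint⇒corresponds (lineB-+ B t) (≤-trans 2≤B (m≤m+n B _))
    (digitPoint-along-line t (corresponds⇒digitPoint c)) (line⊆V ℤring (+ B) xs ys inV (+ t)) inj′
  where
  open ≡-Reasoning
  xs′ = lineX ℤring (+ B) xs ys (+ t)
  ys′ = lineY ℤring (+ B) xs ys (+ t)
  K = suc (B * t) * suc (B * t) + t * t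
  scaled : ∀ i → ∣ xs′ i ℤ.+ lineB ℤring (+ B) (+ t) ℤ.* ys′ i ∣ ≡ ∣ xs i ℤ.+ + B ℤ.* ys i ∣ * K
  scaled i = begin
    ∣ xs′ i ℤ.+ lineB ℤring (+ B) (+ t) ℤ.* ys′ i ∣                   ≡⟨ cong ∣_∣ (line-linear ℤring (+ B) (xs i) (ys i) (+ t)) ⟩
    ∣ (xs i ℤ.+ + B ℤ.* ys i) ℤ.* lineScale ℤring (+ B) (+ t) ∣        ≡⟨ abs-* (xs i ℤ.+ + B ℤ.* ys i) (lineScale ℤring (+ B) (+ t)) ⟩
    ∣ xs i ℤ.+ + B ℤ.* ys i ∣ * ∣ lineScale ℤring (+ B) (+ t) ∣        ≡⟨ cong (∣ xs i ℤ.+ + B ℤ.* ys i ∣ *_) (∣lineScale∣ B t) ⟩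
    ∣ xs i ℤ.+ + B ℤ.* ys i ∣ * K                                     ∎
  inj′ : Injective _≡_ _≡_ (λ i → ∣ xs′ i ℤ.+ lineB ℤring (+ B) (+ t) ℤ.* ys′ i ∣)
  inj′ {i} {j} eq = inj (*-cancelʳ-≡ _ _ K (trans (sym (scaled i)) (trans eq (scaled j))))

theorem2p4 : ∀ {c r} →
    ((R : CommutativeRing c r) → let open CommutativeRing R in
      ∀ k (b0 : Carrier) (xs ys : Fin (suc k) → Carrier) → InV R b0 xs ys →
        ((lineB R b0 0# ≈ b0) × (∀ i → lineX R b0 xs ys 0# i ≈ xs i) × (∀ i → lineY R b0 xs ys 0# i ≈ ys i))
        × (∀ t → InV R (lineB R b0 t) (lineX R b0 xs ys t) (lineY R b0 xs ys t)))
    × (∀ k (b0 : ℤ) (xs ys : Fin (suc k) → ℤ) → Corresponds b0 xs ys →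
        ∀ (t : ℕ) → Corresponds (lineB ℤring b0 (+ t)) (lineX ℤring b0 xs ys (+ t)) (lineY ℤring b0 xs ys (+ t)))
theorem2p4 = (λ R k b0 xs ys inV → line-through-point R b0 xs ys , line⊆V R b0 xs ys inV) , corresponds-along-line
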